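{- For all integers $n,k \geq 1$, \[ C(n,\widehat k) = \sum_{j \geq 0} (-1)^ja(j,n-jk). \]
   Context: A composition of $n$ is a finite sequence of positive integers summing to $n$. $C(n,\widehat k)$ is the number of compositions of $n$ none of whose parts equals $k$. For integers $r\ge0$ and $N\ge0$, $a(r,N)$ is the number of ways to tile a $1\times(N+r)$ grid using $r$ indistinguishable red $1\times1$ squares and white tiles of arbitrary positive integer lengths of total length $N$ (order matters); $a(r,N)=0$ for $N<0$. -}

module Defs where

open import Data.Nat using (ℕ; zero; suc; _+_; _*_; _≤?_; _<?_; _≟_; _≤_)
open import Data.Integer using (ℤ; +_; -[1+_])
import Data.Integer as ℤ
open import Data.Nat.ListAction using (sum)
open import Data.List using (List; []; _∷_; length; map; filter; concatMap; upTo; _++_; foldr)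
open import Data.List.Relation.Unary.All using (All; all?)
open import Data.Product using (_×_; _,_)
open import Relation.Nullary using (Dec; ¬_; yes; no)
open import Relation.Nullary.Decidable using (_×-dec_; ¬?)
open import Relation.Binary.PropositionalEquality using (_≡_)

listsOfLength : {A : Set} → List A → ℕ → List (List A)
listsOfLength xs zero    = [] ∷ []
listsOfLength xs (suc ℓ) = concatMap (λ x → map (x ∷_) (listsOfLength xs ℓ)) xs

listsUpTo : {A : Set} → List A → ℕ → List (List A)
listsUpTo xs L = concatMap (listsOfLength xs) (upTo (suc L))

count : {A : Set} {P : A → Set} → ((x : A) → Dec (P x)) → List A → ℕ
count P? xs = length (filter P? xs)

IsComposition : ℕ → List ℕ → Set
IsComposition n c = All (1 ≤_) c × sum c ≡ n

IsCompositionAvoiding : ℕ → ℕ → List ℕ → Set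
IsCompositionAvoiding n k c = IsComposition n c × All (λ p → ¬ (p ≡ k)) c

isCompositionAvoiding? : ∀ n k c → Dec (IsCompositionAvoiding n k c)
isCompositionAvoiding? n k c =
  (all? (1 ≤?_) c ×-dec (sum c ≟ n)) ×-dec all? (λ p → ¬? (p ≟ k)) c

-- Every composition of n has length ≤ n and parts in {0,…,n}, so it
-- occurs (exactly once) in this candidate list.
-- C(n, k̂)
C-avoid : ℕ → ℕ → ℕ
C-avoid n k = count (isCompositionAvoiding? n k) (listsUpTo (upTo (suc n)) n)

data Tile : Set where
  red   : Tile
  white : ℕ → Tile

isRed : Tile → ℕ
isRed red       = 1
isRed (white _) = 0

whiteLen : Tile → ℕ
whiteLen red       = 0
whiteLen (white m) = m

ValidTile : Tile → Set
ValidTile red       = Data.Unit.⊤ where import Data.Unit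
ValidTile (white m) = 1 ≤ m

validTile? : (t : Tile) → Dec (ValidTile t)
validTile? red       = yes _
validTile? (white m) = 1 ≤? m

-- A tiling (ordered sequence of tiles) of a 1×(N+r) grid with r red unit
-- squares and white tiles of positive lengths of total length N.
IsTiling : ℕ → ℕ → List Tile → Set
IsTiling r N t = All ValidTile t × (sum (map isRed t) ≡ r × sum (map whiteLen t) ≡ N)

isTiling? : ∀ r N t → Dec (IsTiling r N t)
isTiling? r N t = all? validTile? t ×-dec ((sum (map isRed t) ≟ r) ×-dec (sum (map whiteLen t) ≟ N))

-- Candidate tiles: red and white m for m ∈ {0,…,N}; a tiling has at most
-- N + r tiles.
candidateTiles : ℕ → List Tile
candidateTiles N = red ∷ map white (upTo (suc N))

aℕ : ℕ → ℕ → ℕ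
aℕ r N = count (isTiling? r N) (listsUpTo (candidateTiles N) (N + r))

a : ℕ → ℤ → ℕ
a r (+ N)    = aℕ r N
a r -[1+ _ ] = 0

Σ[j≤_]_ : ℕ → (ℕ → ℤ) → ℤ
Σ[j≤ zero  ] f = f 0
Σ[j≤ suc m ] f = (Σ[j≤ m ] f) ℤ.+ f (suc m)

sign : ℕ → ℤ
sign zero    = + 1
sign (suc j) = ℤ.- sign j

module Submission where

-- Both sides satisfy the same recursion in n, obtained by classifying
-- objects by their first entry.
--   * A k-avoiding composition of n is empty (n = 0) or starts with a part
--     m ∈ {1,…,n}, m ≠ k, followed by a k-avoiding composition of n − m:
--       C(n) = [n = 0] + ∑_{1 ≤ m ≤ n, m ≠ k} C(n − m).
--   * A tiling is empty, starts with a red square, or starts with a white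
--     tile of length m; hence a(r, N) = [r = N = 0] + a(r − 1, N) + ∑_{m=1}^{N} a(r, N − m).
--     Substituted into F(n) = ∑_j (−1)^j a(j, n − jk), the red-square terms
--     telescope to −F(n − k), so F(n) = [n = 0] − F(n − k) + ∑_{m=1}^{n} F(n − m),
--     which is the composition recursion with the term m = k removed.
-- The argument works for every n ≥ 0.

open import Defs
open import Algebra.Structures using (IsCommutativeMonoid)
open import Algebra.Bundles using (CommutativeSemigroup)
import Algebra.Properties.CommutativeSemigroup as CommutativeSemigroupProperties
open import Data.Bool using (Bool; true; false; if_then_else_)
open import Data.Bool.Properties using (if-float; if-cong-else)
open import Data.List using (List; []; _∷_; length; map; filter; concatMap; applyUpTo; upTo; _++_)
open import Data.List.Properties using (length-++; filter-++; filter-none; filter-≐)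
open import Data.List.Relation.Unary.All using (_∷_; universal)
open import Data.Nat using (ℕ; zero; suc; _+_; _*_; _∸_; _≤_; _<_; z≤n; s≤s; _≤?_; _<?_; _≟_)
import Data.Nat.Properties as ℕP
open import Data.Nat.Induction using (<-rec)
open import Data.Nat.ListAction using (sum)
open import Data.Integer using (ℤ; +_; -_; _-_)
import Data.Integer as ℤ
import Data.Integer.Properties as ℤP
open import Data.Integer.Tactic.RingSolver using (solve-∀)
open import Data.Product using (_×_; _,_; proj₁; proj₂)
open import Function using (_∘_)
open import Relation.Nullary using (Dec; yes; no; ¬_; does; contradiction)
open import Relation.Unary using (Decidable)
open import Relation.Binary.PropositionalEquality

module FiniteSums {A : Set} {_∙_ : A → A → A} {ε : A}
                  (isCM : IsCommutativeMonoid _≡_ _∙_ ε) where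

  open IsCommutativeMonoid isCM using (assoc; identityˡ; identityʳ; isCommutativeSemigroup)

  commutativeSemigroup : CommutativeSemigroup _ _
  commutativeSemigroup = record { isCommutativeSemigroup = isCommutativeSemigroup }
  open CommutativeSemigroupProperties commutativeSemigroup using (interchange)

  ∑ : ℕ → (ℕ → A) → A
  ∑ zero    f = ε
  ∑ (suc n) f = f 0 ∙ ∑ n (f ∘ suc)

  ∑ᴸ : {B : Set} → List B → (B → A) → A
  ∑ᴸ []       g = ε
  ∑ᴸ (x ∷ xs) g = g x ∙ ∑ᴸ xs g

  ∑-cong : ∀ n {f g : ℕ → A} → (∀ y → y < n → f y ≡ g y) → ∑ n f ≡ ∑ n g
  ∑-cong zero    f≡g = refl
  ∑-cong (suc n) f≡g = cong₂ _∙_ (f≡g 0 (s≤s z≤n)) (∑-cong n (λ y y<n → f≡g (suc y) (s≤s y<n)))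

  ∑-zero : ∀ n {f : ℕ → A} → (∀ y → y < n → f y ≡ ε) → ∑ n f ≡ ε
  ∑-zero zero    f≡ε = refl
  ∑-zero (suc n) f≡ε = trans (cong₂ _∙_ (f≡ε 0 (s≤s z≤n)) (∑-zero n (λ y y<n → f≡ε (suc y) (s≤s y<n))))
                             (identityˡ ε)

  ∑-truncate : ∀ {m n} {f : ℕ → A} → m ≤ n → (∀ y → m ≤ y → y < n → f y ≡ ε) → ∑ n f ≡ ∑ m f
  ∑-truncate {n = n} z≤n     f≡ε = ∑-zero n (λ y → f≡ε y z≤n)
  ∑-truncate {f = f} (s≤s m≤n) f≡ε =
    cong (f 0 ∙_) (∑-truncate m≤n (λ y m≤y y<n → f≡ε (suc y) (s≤s m≤y) (s≤s y<n)))

  -- Splitting off the last term (the sums of Defs are built from the right).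
  ∑-last : ∀ n (f : ℕ → A) → ∑ (suc n) f ≡ ∑ n f ∙ f n
  ∑-last zero    f = trans (identityʳ (f 0)) (sym (identityˡ (f 0)))
  ∑-last (suc n) f = trans (cong (f 0 ∙_) (∑-last n (f ∘ suc))) (sym (assoc (f 0) _ _))

  ∑-distrib : ∀ n (f g : ℕ → A) → ∑ n (λ y → f y ∙ g y) ≡ ∑ n f ∙ ∑ n g
  ∑-distrib zero    f g = sym (identityˡ ε)
  ∑-distrib (suc n) f g =
    trans (cong ((f 0 ∙ g 0) ∙_) (∑-distrib n (f ∘ suc) (g ∘ suc)))
          (interchange (f 0) (g 0) (∑ n (f ∘ suc)) (∑ n (g ∘ suc)))

  ∑ᴸ-cong : {B : Set} (xs : List B) {f g : B → A} → (∀ x → f x ≡ g x) → ∑ᴸ xs f ≡ ∑ᴸ xs g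
  ∑ᴸ-cong []       f≡g = refl
  ∑ᴸ-cong (x ∷ xs) f≡g = cong₂ _∙_ (f≡g x) (∑ᴸ-cong xs f≡g)

  ∑ᴸ-distrib : {B : Set} (xs : List B) (f g : B → A) → ∑ᴸ xs (λ x → f x ∙ g x) ≡ ∑ᴸ xs f ∙ ∑ᴸ xs g
  ∑ᴸ-distrib []       f g = sym (identityˡ ε)
  ∑ᴸ-distrib (x ∷ xs) f g =
    trans (cong ((f x ∙ g x) ∙_) (∑ᴸ-distrib xs f g)) (interchange (f x) (g x) (∑ᴸ xs f) (∑ᴸ xs g))

  ∑ᴸ-zero : {B : Set} (xs : List B) → ∑ᴸ xs (λ _ → ε) ≡ ε
  ∑ᴸ-zero []       = refl
  ∑ᴸ-zero (x ∷ xs) = trans (cong (ε ∙_) (∑ᴸ-zero xs)) (identityˡ ε)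

  ∑-∑ᴸ-comm : ∀ n {B : Set} (xs : List B) (h : ℕ → B → A) →
              ∑ n (λ y → ∑ᴸ xs (h y)) ≡ ∑ᴸ xs (λ x → ∑ n (λ y → h y x))
  ∑-∑ᴸ-comm zero    xs h = sym (∑ᴸ-zero xs)
  ∑-∑ᴸ-comm (suc n) xs h =
    trans (cong (∑ᴸ xs (h 0) ∙_) (∑-∑ᴸ-comm n xs (h ∘ suc)))
          (sym (∑ᴸ-distrib xs (h 0) (λ x → ∑ n (λ y → h (suc y) x))))

  ∑ᴸ-applyUpTo : ∀ n (f : ℕ → ℕ) (g : ℕ → A) → ∑ᴸ (applyUpTo f n) g ≡ ∑ n (g ∘ f)
  ∑ᴸ-applyUpTo zero    f g = refl
  ∑ᴸ-applyUpTo (suc n) f g = cong (g (f 0) ∙_) (∑ᴸ-applyUpTo n (f ∘ suc) g)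

  ∑ᴸ-upTo : ∀ n (g : ℕ → A) → ∑ᴸ (upTo n) g ≡ ∑ n g
  ∑ᴸ-upTo n = ∑ᴸ-applyUpTo n (λ y → y)

  ∑ᴸ-map : {B C : Set} (f : C → B) (xs : List C) (g : B → A) → ∑ᴸ (map f xs) g ≡ ∑ᴸ xs (g ∘ f)
  ∑ᴸ-map f []       g = refl
  ∑ᴸ-map f (x ∷ xs) g = cong (g (f x) ∙_) (∑ᴸ-map f xs g)

  ∑-comm : ∀ m n (h : ℕ → ℕ → A) → ∑ m (λ j → ∑ n (h j)) ≡ ∑ n (λ y → ∑ m (λ j → h j y))
  ∑-comm m n h = begin
    ∑ m (λ j → ∑ n (h j))              ≡⟨ ∑ᴸ-upTo m (λ j → ∑ n (h j)) ⟨
    ∑ᴸ (upTo m) (λ j → ∑ n (h j))      ≡⟨ ∑-∑ᴸ-comm n (upTo m) (λ y j → h j y) ⟨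
    ∑ n (λ y → ∑ᴸ (upTo m) (λ j → h j y)) ≡⟨ ∑-cong n (λ y _ → ∑ᴸ-upTo m (λ j → h j y)) ⟩
    ∑ n (λ y → ∑ m (λ j → h j y))      ∎
    where open ≡-Reasoning

  ∑-point : ∀ n c (h : ℕ → A) →
            ∑ n (λ y → if does (y ≟ c) then h y else ε) ≡ (if does (c <? n) then h c else ε)
  ∑-point zero    c       h = refl
  ∑-point (suc n) zero    h = trans (cong (h 0 ∙_) (∑-zero n (λ _ _ → refl))) (identityʳ (h 0))
  ∑-point (suc n) (suc c) h = trans (identityˡ _) (∑-point n c (h ∘ suc))

  ∑-separate : ∀ n c (h : ℕ → A) →
               ∑ n h ≡ (if does (c <? n) then h c else ε) ∙ ∑ n (λ y → if does (y ≟ c) then ε else h y)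
  ∑-separate n c h = begin
    ∑ n h                                   ≡⟨ ∑-cong n (λ y _ → split (does (y ≟ c)) (h y)) ⟩
    ∑ n (λ y → (if does (y ≟ c) then h y else ε) ∙ (if does (y ≟ c) then ε else h y))
      ≡⟨ ∑-distrib n _ _ ⟩
    ∑ n (λ y → if does (y ≟ c) then h y else ε) ∙ ∑ n (λ y → if does (y ≟ c) then ε else h y)
      ≡⟨ cong (_∙ ∑ n (λ y → if does (y ≟ c) then ε else h y)) (∑-point n c h) ⟩
    (if does (c <? n) then h c else ε) ∙ ∑ n (λ y → if does (y ≟ c) then ε else h y) ∎
    where
    open ≡-Reasoning
    split : ∀ (b : Bool) x → x ≡ (if b then x else ε) ∙ (if b then ε else x)
    split true  x = sym (identityʳ x)
    split false x = sym (identityˡ x)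

module ℕΣ = FiniteSums ℕP.+-0-isCommutativeMonoid
module ℤΣ = FiniteSums ℤP.+-0-isCommutativeMonoid

module Counting where

  open ℕΣ

  module _ {A : Set} {P : A → Set} (P? : Decidable P) where

    count-++ : ∀ xs ys → count P? (xs ++ ys) ≡ count P? xs + count P? ys
    count-++ xs ys = trans (cong length (filter-++ P? xs ys)) (length-++ (filter P? xs))

    count-concatMap : {B : Set} (f : B → List A) (xs : List B) →
                      count P? (concatMap f xs) ≡ ∑ᴸ xs (count P? ∘ f)
    count-concatMap f []       = refl
    count-concatMap f (x ∷ xs) =
      trans (count-++ (f x) (concatMap f xs)) (cong (_+_ (count P? (f x))) (count-concatMap f xs))

    count-none : (∀ x → ¬ P x) → ∀ xs → count P? xs ≡ 0
    count-none ¬P xs = cong length (filter-none P? (universal ¬P xs))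

    count-map : {B : Set} (g : B → A) (ys : List B) → count P? (map g ys) ≡ count (λ y → P? (g y)) ys
    count-map g []       = refl
    count-map g (y ∷ ys) with does (P? (g y))
    ... | true  = cong suc (count-map g ys)
    ... | false = count-map g ys

  count-cong : {A : Set} {P Q : A → Set} (P? : Decidable P) (Q? : Decidable Q) →
               (∀ {x} → P x → Q x) → (∀ {x} → Q x → P x) → ∀ xs → count P? xs ≡ count Q? xs
  count-cong P? Q? P⇒Q Q⇒P xs = cong length (filter-≐ P? Q? (P⇒Q , Q⇒P) xs)

  countBelow : {A : Set} {P : List A → Set} → Decidable P → List A → ℕ → ℕ
  countBelow P? xs L = ∑ L (λ ℓ → count P? (listsOfLength xs ℓ))

  module _ {A : Set} {P : List A → Set} (P? : Decidable P) (xs : List A) where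

    count-listsUpTo : ∀ L → count P? (listsUpTo xs L) ≡ countBelow P? xs (suc L)
    count-listsUpTo L = trans (count-concatMap P? (listsOfLength xs) (upTo (suc L)))
                              (∑ᴸ-upTo (suc L) (λ ℓ → count P? (listsOfLength xs ℓ)))

    -- A counted list is either empty or determined by its first entry and its tail.
    countBelow-suc : ∀ L → countBelow P? xs (suc L)
                     ≡ count P? ([] ∷ []) + ∑ᴸ xs (λ x → countBelow (λ c → P? (x ∷ c)) xs L)
    countBelow-suc L = cong (_+_ (count P? ([] ∷ []))) (begin
      ∑ L (λ ℓ → count P? (listsOfLength xs (suc ℓ)))
        ≡⟨ ∑-cong L (λ ℓ _ → count-by-head ℓ) ⟩
      ∑ L (λ ℓ → ∑ᴸ xs (λ x → count (λ c → P? (x ∷ c)) (listsOfLength xs ℓ)))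
        ≡⟨ ∑-∑ᴸ-comm L xs (λ ℓ x → count (λ c → P? (x ∷ c)) (listsOfLength xs ℓ)) ⟩
      ∑ᴸ xs (λ x → countBelow (λ c → P? (x ∷ c)) xs L) ∎)
      where
      open ≡-Reasoning
      count-by-head : ∀ ℓ → count P? (listsOfLength xs (suc ℓ))
                            ≡ ∑ᴸ xs (λ x → count (λ c → P? (x ∷ c)) (listsOfLength xs ℓ))
      count-by-head ℓ = trans (count-concatMap P? (λ x → map (x ∷_) (listsOfLength xs ℓ)) xs)
                              (∑ᴸ-cong xs (λ x → count-map P? (x ∷_) (listsOfLength xs ℓ)))

  countBelow-cong : {A : Set} {P Q : List A → Set} (P? : Decidable P) (Q? : Decidable Q) →
                    (∀ {c} → P c → Q c) → (∀ {c} → Q c → P c) →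
                    ∀ xs L → countBelow P? xs L ≡ countBelow Q? xs L
  countBelow-cong P? Q? P⇒Q Q⇒P xs L =
    ∑-cong L (λ ℓ _ → count-cong P? Q? P⇒Q Q⇒P (listsOfLength xs ℓ))

  countBelow-none : {A : Set} {P : List A → Set} (P? : Decidable P) →
                    (∀ c → ¬ P c) → ∀ xs L → countBelow P? xs L ≡ 0
  countBelow-none P? ¬P xs L = ∑-zero L (λ ℓ _ → count-none P? ¬P (listsOfLength xs ℓ))

  ∑-parts : ∀ {n M} (g : ℕ → ℕ) → n ≤ M → g 0 ≡ 0 → (∀ y → n ≤ y → g (suc y) ≡ 0) →
            ∑ᴸ (upTo (suc M)) g ≡ ∑ n (g ∘ suc)
  ∑-parts {n} {M} g n≤M g0≡0 g-large≡0 = begin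
    ∑ᴸ (upTo (suc M)) g ≡⟨ ∑ᴸ-upTo (suc M) g ⟩
    g 0 + ∑ M (g ∘ suc) ≡⟨ cong (_+ ∑ M (g ∘ suc)) g0≡0 ⟩
    ∑ M (g ∘ suc)       ≡⟨ ∑-truncate n≤M (λ y n≤y _ → g-large≡0 y n≤y) ⟩
    ∑ n (g ∘ suc)       ∎
    where open ≡-Reasoning

δ₀ : ℕ → ℕ
δ₀ zero    = 1
δ₀ (suc _) = 0

remainder-< : ∀ {n y} → y < n → n ∸ suc y < n
remainder-< y<n = ℕP.∸-monoʳ-< (s≤s z≤n) y<n

remainder-≤ : ∀ {n M} y → n ≤ M → n ∸ suc y ≤ M
remainder-≤ {n} y n≤M = ℕP.≤-trans (ℕP.m∸n≤m n (suc y)) n≤M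

flip-∸ : ∀ {n b c} → b ≤ n → c ≤ n ∸ b → b ≤ n ∸ c
flip-∸ {n} {b} {c} b≤n c≤n∸b =
  ℕP.m+n≤o⇒m≤o∸n b (subst (_≤ n) (ℕP.+-comm c b) (ℕP.m≤o∸n⇒m+n≤o c b≤n c≤n∸b))

∸-comm : ∀ n b c → n ∸ b ∸ c ≡ n ∸ c ∸ b
∸-comm n b c = trans (ℕP.∸-+-assoc n b c) (trans (cong (n ∸_) (ℕP.+-comm b c)) (sym (ℕP.∸-+-assoc n c b)))

module Compositions (k : ℕ) where

  open ℕΣ
  open Counting

  C≤ : ℕ → ℕ → ℕ → ℕ
  C≤ M L n = countBelow (isCompositionAvoiding? n k) (upTo (suc M)) L

  C≤-starting : ℕ → ℕ → ℕ → ℕ → ℕ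
  C≤-starting M L n m = countBelow (λ c → isCompositionAvoiding? n k (m ∷ c)) (upTo (suc M)) L

  uncons : ∀ {n m c} → IsCompositionAvoiding n k (m ∷ c) →
           (1 ≤ m × ¬ m ≡ k × m ≤ n) × IsCompositionAvoiding (n ∸ m) k c
  uncons {m = m} {c} ((1≤m ∷ positive , m+∑c≡n) , m≢k ∷ avoiding) =
    (1≤m , m≢k , subst (m ≤_) m+∑c≡n (ℕP.m≤m+n m (sum c))) ,
    ((positive , trans (sym (ℕP.m+n∸m≡n m (sum c))) (cong (_∸ m) m+∑c≡n)) , avoiding)

  cons : ∀ {n m c} → 1 ≤ m → ¬ m ≡ k → m ≤ n → IsCompositionAvoiding (n ∸ m) k c →
         IsCompositionAvoiding n k (m ∷ c)
  cons {m = m} 1≤m m≢k m≤n ((positive , ∑c≡n∸m) , avoiding) =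
    ((1≤m ∷ positive) , trans (cong (_+_ m) ∑c≡n∸m) (ℕP.m+[n∸m]≡n m≤n)) , m≢k ∷ avoiding

  empty-composition : ∀ n → count (isCompositionAvoiding? n k) ([] ∷ []) ≡ δ₀ n
  empty-composition zero    = refl
  empty-composition (suc n) = refl

  starting-0 : ∀ M L n → C≤-starting M L n 0 ≡ 0
  starting-0 M L n = countBelow-none _ (λ c p → ℕP.<⇒≱ (proj₁ (proj₁ (uncons p))) z≤n) _ L

  starting-large : ∀ M L n m → n < m → C≤-starting M L n m ≡ 0
  starting-large M L n m n<m =
    countBelow-none _ (λ c p → ℕP.<⇒≱ n<m (proj₂ (proj₂ (proj₁ (uncons p))))) _ L

  starting-part : ∀ M L n y → y < n →
                  C≤-starting M L n (suc y) ≡ (if does (suc y ≟ k) then 0 else C≤ M L (n ∸ suc y))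
  starting-part M L n y y<n = by-decision (suc y ≟ k)
    where
    by-decision : (d : Dec (suc y ≡ k)) →
                  C≤-starting M L n (suc y) ≡ (if does d then 0 else C≤ M L (n ∸ suc y))
    by-decision (yes 1+y≡k) = countBelow-none _ (λ c p → proj₁ (proj₂ (proj₁ (uncons p))) 1+y≡k) _ L
    by-decision (no  1+y≢k) = countBelow-cong _ _ (λ p → proj₂ (uncons p)) (cons (s≤s z≤n) 1+y≢k y<n) _ L

  C≤-rec : ∀ {M n} L → n ≤ M →
           C≤ M (suc L) n ≡ δ₀ n + ∑ n (λ y → if does (suc y ≟ k) then 0 else C≤ M L (n ∸ suc y))
  C≤-rec {M} {n} L n≤M = begin
    C≤ M (suc L) n
      ≡⟨ countBelow-suc (isCompositionAvoiding? n k) (upTo (suc M)) L ⟩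
    count (isCompositionAvoiding? n k) ([] ∷ []) + ∑ᴸ (upTo (suc M)) (C≤-starting M L n)
      ≡⟨ cong₂ _+_ (empty-composition n)
                   (∑-parts (C≤-starting M L n) n≤M (starting-0 M L n)
                            (λ y n≤y → starting-large M L n (suc y) (s≤s n≤y))) ⟩
    δ₀ n + ∑ n (C≤-starting M L n ∘ suc)
      ≡⟨ cong (_+_ (δ₀ n)) (∑-cong n (starting-part M L n)) ⟩
    δ₀ n + ∑ n (λ y → if does (suc y ≟ k) then 0 else C≤ M L (n ∸ suc y)) ∎
    where open ≡-Reasoning

  C≤-stable : ∀ {M M′ L L′ n} → n ≤ M → n ≤ M′ → n < L → n < L′ → C≤ M L n ≡ C≤ M′ L′ n
  C≤-stable {M} {M′} {suc L} {suc L′} {n} n≤M n≤M′ (s≤s n≤L) (s≤s n≤L′) = begin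
    C≤ M (suc L) n
      ≡⟨ C≤-rec L n≤M ⟩
    δ₀ n + ∑ n (λ y → if does (suc y ≟ k) then 0 else C≤ M L (n ∸ suc y))
      ≡⟨ cong (_+_ (δ₀ n)) (∑-cong n (λ y y<n → if-cong-else (does (suc y ≟ k)) (remainder y<n))) ⟩
    δ₀ n + ∑ n (λ y → if does (suc y ≟ k) then 0 else C≤ M′ L′ (n ∸ suc y))
      ≡⟨ C≤-rec L′ n≤M′ ⟨
    C≤ M′ (suc L′) n ∎
    where
    open ≡-Reasoning
    remainder : ∀ {y} → y < n → C≤ M L (n ∸ suc y) ≡ C≤ M′ L′ (n ∸ suc y)
    remainder {y} y<n = C≤-stable (remainder-≤ y n≤M) (remainder-≤ y n≤M′)
      (ℕP.<-≤-trans (remainder-< y<n) n≤L) (ℕP.<-≤-trans (remainder-< y<n) n≤L′)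

  C-avoid≡C≤ : ∀ n → C-avoid n k ≡ C≤ n (suc n) n
  C-avoid≡C≤ n = count-listsUpTo (isCompositionAvoiding? n k) (upTo (suc n)) n

  C-avoid-rec : ∀ n → C-avoid n k
                ≡ δ₀ n + ∑ n (λ y → if does (suc y ≟ k) then 0 else C-avoid (n ∸ suc y) k)
  C-avoid-rec n = begin
    C-avoid n k
      ≡⟨ C-avoid≡C≤ n ⟩
    C≤ n (suc n) n
      ≡⟨ C≤-rec n ℕP.≤-refl ⟩
    δ₀ n + ∑ n (λ y → if does (suc y ≟ k) then 0 else C≤ n n (n ∸ suc y))
      ≡⟨ cong (_+_ (δ₀ n)) (∑-cong n (λ y y<n → if-cong-else (does (suc y ≟ k)) (remainder y<n))) ⟩
    δ₀ n + ∑ n (λ y → if does (suc y ≟ k) then 0 else C-avoid (n ∸ suc y) k) ∎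
    where
    open ≡-Reasoning
    remainder : ∀ {y} → y < n → C≤ n n (n ∸ suc y) ≡ C-avoid (n ∸ suc y) k
    remainder {y} y<n = trans (C≤-stable (remainder-≤ y ℕP.≤-refl) ℕP.≤-refl (remainder-< y<n) ℕP.≤-refl)
                              (sym (C-avoid≡C≤ (n ∸ suc y)))

module Tilings where

  open ℕΣ
  open Counting

  A≤ : ℕ → ℕ → ℕ → ℕ → ℕ
  A≤ M L r N = countBelow (isTiling? r N) (candidateTiles M) L

  A≤-starting : ℕ → ℕ → ℕ → ℕ → Tile → ℕ
  A≤-starting M L r N t = countBelow (λ ts → isTiling? r N (t ∷ ts)) (candidateTiles M) L

  empty-tiling : ∀ N → count (isTiling? 0 N) ([] ∷ []) ≡ δ₀ N
  empty-tiling zero    = refl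
  empty-tiling (suc N) = refl

  red-first-0 : ∀ M L N → A≤-starting M L 0 N red ≡ 0
  red-first-0 M L N = countBelow-none _ (λ { ts (_ , () , _) }) _ L

  red-first-suc : ∀ M L r N → A≤-starting M L (suc r) N red ≡ A≤ M L r N
  red-first-suc M L r N = countBelow-cong _ _
    (λ { (_ ∷ valid , reds , whites) → valid , ℕP.suc-injective reds , whites })
    (λ { (valid , reds , whites) → _ ∷ valid , cong suc reds , whites }) _ L

  white-first-0 : ∀ M L r N → A≤-starting M L r N (white 0) ≡ 0
  white-first-0 M L r N = countBelow-none _ (λ { ts (() ∷ _ , _) }) _ L

  white-first-large : ∀ M L r N y → N < suc y → A≤-starting M L r N (white (suc y)) ≡ 0
  white-first-large M L r N y N<1+y = countBelow-none _
    (λ { ts (_ ∷ _ , _ , whites) → ℕP.<⇒≱ N<1+y (subst (suc y ≤_) whites (ℕP.m≤m+n (suc y) _)) }) _ L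

  white-first-part : ∀ M L r N y → y < N → A≤-starting M L r N (white (suc y)) ≡ A≤ M L r (N ∸ suc y)
  white-first-part M L r N y y<N = countBelow-cong _ _
    (λ { (_ ∷ valid , reds , whites) →
         valid , reds , trans (sym (ℕP.m+n∸m≡n (suc y) _)) (cong (_∸ suc y) whites) })
    (λ { (valid , reds , whites) →
         s≤s z≤n ∷ valid , reds , trans (cong (_+_ (suc y)) whites) (ℕP.m+[n∸m]≡n y<N) }) _ L

  white-first : ∀ {M N} L r → N ≤ M →
                ∑ᴸ (map white (upTo (suc M))) (A≤-starting M L r N) ≡ ∑ N (λ y → A≤ M L r (N ∸ suc y))
  white-first {M} {N} L r N≤M = begin
    ∑ᴸ (map white (upTo (suc M))) (A≤-starting M L r N)
      ≡⟨ ∑ᴸ-map white (upTo (suc M)) (A≤-starting M L r N) ⟩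
    ∑ᴸ (upTo (suc M)) (A≤-starting M L r N ∘ white)
      ≡⟨ ∑-parts (A≤-starting M L r N ∘ white) N≤M (white-first-0 M L r N)
                 (λ y N≤y → white-first-large M L r N y (s≤s N≤y)) ⟩
    ∑ N (λ y → A≤-starting M L r N (white (suc y)))
      ≡⟨ ∑-cong N (white-first-part M L r N) ⟩
    ∑ N (λ y → A≤ M L r (N ∸ suc y)) ∎
    where open ≡-Reasoning

  A≤-rec-0 : ∀ {M N} L → N ≤ M → A≤ M (suc L) 0 N ≡ δ₀ N + ∑ N (λ y → A≤ M L 0 (N ∸ suc y))
  A≤-rec-0 {M} {N} L N≤M = trans (countBelow-suc (isTiling? 0 N) (candidateTiles M) L)
    (cong₂ _+_ (empty-tiling N) (cong₂ _+_ (red-first-0 M L N) (white-first L 0 N≤M)))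

  A≤-rec-suc : ∀ {M N} L r → N ≤ M →
               A≤ M (suc L) (suc r) N ≡ A≤ M L r N + ∑ N (λ y → A≤ M L (suc r) (N ∸ suc y))
  A≤-rec-suc {M} {N} L r N≤M = trans (countBelow-suc (isTiling? (suc r) N) (candidateTiles M) L)
    (cong₂ _+_ (red-first-suc M L r N) (white-first L (suc r) N≤M))

  A≤-stable : ∀ {M M′ L L′ r N} → N ≤ M → N ≤ M′ → N + r < L → N + r < L′ → A≤ M L r N ≡ A≤ M′ L′ r N
  A≤-stable-white : ∀ {M M′ L L′ r N} → N ≤ M → N ≤ M′ → N + r ≤ L → N + r ≤ L′ →
                    ∑ N (λ y → A≤ M L r (N ∸ suc y)) ≡ ∑ N (λ y → A≤ M′ L′ r (N ∸ suc y))

  A≤-stable {M} {M′} {suc L} {suc L′} {zero} {N} N≤M N≤M′ (s≤s bound) (s≤s bound′) = begin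
    A≤ M (suc L) 0 N                         ≡⟨ A≤-rec-0 L N≤M ⟩
    δ₀ N + ∑ N (λ y → A≤ M L 0 (N ∸ suc y))  ≡⟨ cong (_+_ (δ₀ N)) (A≤-stable-white N≤M N≤M′ bound bound′) ⟩
    δ₀ N + ∑ N (λ y → A≤ M′ L′ 0 (N ∸ suc y)) ≡⟨ A≤-rec-0 L′ N≤M′ ⟨
    A≤ M′ (suc L′) 0 N                       ∎
    where open ≡-Reasoning
  A≤-stable {M} {M′} {suc L} {suc L′} {suc r} {N} N≤M N≤M′ (s≤s bound) (s≤s bound′) = begin
    A≤ M (suc L) (suc r) N
      ≡⟨ A≤-rec-suc L r N≤M ⟩
    A≤ M L r N + ∑ N (λ y → A≤ M L (suc r) (N ∸ suc y))
      ≡⟨ cong₂ _+_ (A≤-stable N≤M N≤M′ (one-red-fewer bound) (one-red-fewer bound′))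
                   (A≤-stable-white N≤M N≤M′ bound bound′) ⟩
    A≤ M′ L′ r N + ∑ N (λ y → A≤ M′ L′ (suc r) (N ∸ suc y))
      ≡⟨ A≤-rec-suc L′ r N≤M′ ⟨
    A≤ M′ (suc L′) (suc r) N ∎
    where
    open ≡-Reasoning
    one-red-fewer : ∀ {L} → N + suc r ≤ L → N + r < L
    one-red-fewer {L} = subst (_≤ L) (ℕP.+-suc N r)

  A≤-stable-white {r = r} {N} N≤M N≤M′ bound bound′ = ∑-cong N (λ y y<N →
    A≤-stable (remainder-≤ y N≤M) (remainder-≤ y N≤M′)
              (ℕP.<-≤-trans (ℕP.+-monoˡ-< r (remainder-< y<N)) bound)
              (ℕP.<-≤-trans (ℕP.+-monoˡ-< r (remainder-< y<N)) bound′))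

  aℕ≡A≤ : ∀ r N → aℕ r N ≡ A≤ N (suc (N + r)) r N
  aℕ≡A≤ r N = count-listsUpTo (isTiling? r N) (candidateTiles N) (N + r)

  remainder-aℕ : ∀ {r N y} → y < N → A≤ N (N + r) r (N ∸ suc y) ≡ aℕ r (N ∸ suc y)
  remainder-aℕ {r} {N} {y} y<N =
    trans (A≤-stable (remainder-≤ y ℕP.≤-refl) ℕP.≤-refl (ℕP.+-monoˡ-< r (remainder-< y<N)) ℕP.≤-refl)
          (sym (aℕ≡A≤ r (N ∸ suc y)))

  one-red-fewer-aℕ : ∀ r N → A≤ N (N + suc r) r N ≡ aℕ r N
  one-red-fewer-aℕ r N =
    trans (A≤-stable ℕP.≤-refl ℕP.≤-refl (ℕP.+-monoʳ-< N (ℕP.n<1+n r)) ℕP.≤-refl) (sym (aℕ≡A≤ r N))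

  aℕ-rec-0 : ∀ N → aℕ 0 N ≡ δ₀ N + ∑ N (λ y → aℕ 0 (N ∸ suc y))
  aℕ-rec-0 N = begin
    aℕ 0 N                                          ≡⟨ aℕ≡A≤ 0 N ⟩
    A≤ N (suc (N + 0)) 0 N                          ≡⟨ A≤-rec-0 (N + 0) ℕP.≤-refl ⟩
    δ₀ N + ∑ N (λ y → A≤ N (N + 0) 0 (N ∸ suc y))   ≡⟨ cong (_+_ (δ₀ N)) (∑-cong N (λ _ → remainder-aℕ)) ⟩
    δ₀ N + ∑ N (λ y → aℕ 0 (N ∸ suc y))             ∎
    where open ≡-Reasoning

  aℕ-rec-suc : ∀ r N → aℕ (suc r) N ≡ aℕ r N + ∑ N (λ y → aℕ (suc r) (N ∸ suc y))
  aℕ-rec-suc r N = begin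
    aℕ (suc r) N
      ≡⟨ aℕ≡A≤ (suc r) N ⟩
    A≤ N (suc (N + suc r)) (suc r) N
      ≡⟨ A≤-rec-suc (N + suc r) r ℕP.≤-refl ⟩
    A≤ N (N + suc r) r N + ∑ N (λ y → A≤ N (N + suc r) (suc r) (N ∸ suc y))
      ≡⟨ cong₂ _+_ (one-red-fewer-aℕ r N) (∑-cong N (λ _ → remainder-aℕ)) ⟩
    aℕ r N + ∑ N (λ y → aℕ (suc r) (N ∸ suc y)) ∎
    where open ≡-Reasoning

module SignedSums where

  open ℤΣ

  ∑-neg : ∀ n (f : ℕ → ℤ) → ∑ n (λ y → - f y) ≡ - ∑ n f
  ∑-neg zero    f = refl
  ∑-neg (suc n) f = trans (cong (ℤ._+_ (- f 0)) (∑-neg n (f ∘ suc))) (sym (ℤP.neg-distrib-+ (f 0) _))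

  ∑-sub : ∀ n (f g : ℕ → ℤ) → ∑ n (λ y → f y - g y) ≡ ∑ n f - ∑ n g
  ∑-sub n f g = trans (∑-distrib n f (λ y → - g y)) (cong (ℤ._+_ (∑ n f)) (∑-neg n g))

  ∑-scale : ∀ n c (f : ℕ → ℤ) → c ℤ.* ∑ n f ≡ ∑ n (λ y → c ℤ.* f y)
  ∑-scale zero    c f = ℤP.*-zeroʳ c
  ∑-scale (suc n) c f = trans (ℤP.*-distribˡ-+ c (f 0) _) (cong (ℤ._+_ (c ℤ.* f 0)) (∑-scale n c (f ∘ suc)))

  pos-∑ : ∀ n (f : ℕ → ℕ) → + ℕΣ.∑ n f ≡ ∑ n (λ y → + f y)
  pos-∑ zero    f = refl
  pos-∑ (suc n) f = trans (ℤP.pos-+ (f 0) _) (cong (ℤ._+_ (+ f 0)) (pos-∑ n (f ∘ suc)))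

  Σ[j≤]≡∑ : ∀ n (f : ℕ → ℤ) → Σ[j≤ n ] f ≡ ∑ (suc n) f
  Σ[j≤]≡∑ zero    f = sym (ℤP.+-identityʳ (f 0))
  Σ[j≤]≡∑ (suc n) f = trans (cong (ℤ._+ f (suc n)) (Σ[j≤]≡∑ n f)) (sym (∑-last (suc n) f))

  rearrange : ∀ d b s t → (d ℤ.+ s) - (b ℤ.+ t) ≡ (d - b) ℤ.+ (s - t)
  rearrange = solve-∀

  cancel : ∀ d b s → (d - b) ℤ.+ (b ℤ.+ s) ≡ d ℤ.+ s
  cancel = solve-∀

-- T n j = a(j, n − jk), the j-th term of the alternating sum; its recursions
-- in n come from those of a, the red-first term shifting n by k.
module ShiftedTilings (k : ℕ) where

  open ℕΣ
  open Tilings using (aℕ-rec-0; aℕ-rec-suc)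

  T : ℕ → ℕ → ℕ
  T n j = a j (+ n - + (j * k))

  T-above : ∀ {n} j → j * k ≤ n → T n j ≡ aℕ j (n ∸ j * k)
  T-above {n} j jk≤n = cong (a j) (trans (ℤP.m-n≡m⊖n n (j * k)) (ℤP.⊖-≥ jk≤n))

  T-below : ∀ {n} j → n < j * k → T n j ≡ 0
  T-below {n} j n<jk =
    trans (cong (a j) (trans (ℤP.m-n≡m⊖n n (j * k)) (ℤP.⊖-< n<jk))) (a-negative (ℕP.m<n⇒0<n∸m n<jk))
    where
    a-negative : ∀ {r d} → 0 < d → a r (- + d) ≡ 0
    a-negative {d = suc _} _ = refl

  T-shift : ∀ {n} j → j * k ≤ n →
            ∑ n (λ y → T (n ∸ suc y) j) ≡ ∑ (n ∸ j * k) (λ y → aℕ j (n ∸ j * k ∸ suc y))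
  T-shift {n} j jk≤n = trans (∑-truncate (ℕP.m∸n≤m n (j * k)) vanishing) (∑-cong (n ∸ j * k) shifted)
    where
    vanishing : ∀ y → n ∸ j * k ≤ y → y < n → T (n ∸ suc y) j ≡ 0
    vanishing y n∸jk≤y y<n = T-below j (ℕP.≰⇒> (λ jk≤ → ℕP.<⇒≱ (flip-∸ y<n jk≤) n∸jk≤y))
    shifted : ∀ y → y < n ∸ j * k → T (n ∸ suc y) j ≡ aℕ j (n ∸ j * k ∸ suc y)
    shifted y y<n∸jk = trans (T-above j (flip-∸ jk≤n y<n∸jk)) (cong (aℕ j) (∸-comm n (suc y) (j * k)))

  T-rec-0 : ∀ n → T n 0 ≡ δ₀ n + ∑ n (λ y → T (n ∸ suc y) 0)
  T-rec-0 n = trans (T-above {n} 0 z≤n) (trans (aℕ-rec-0 n) (cong (_+_ (δ₀ n)) (sym (T-shift {n} 0 z≤n))))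

  red-above : ∀ {n} j → suc j * k ≤ n → (d : Dec (k ≤ n)) →
              (if does d then T (n ∸ k) j else 0) ≡ aℕ j (n ∸ suc j * k)
  red-above {n} j jk≤n (yes k≤n) =
    trans (T-above j (ℕP.m+n≤o⇒m≤o∸n (j * k) (subst (_≤ n) (ℕP.+-comm k (j * k)) jk≤n)))
          (cong (aℕ j) (ℕP.∸-+-assoc n k (j * k)))
  red-above j jk≤n (no k≰n) = contradiction (ℕP.m+n≤o⇒m≤o k jk≤n) k≰n

  red-below : ∀ {n} j → n < suc j * k → (d : Dec (k ≤ n)) → (if does d then T (n ∸ k) j else 0) ≡ 0
  red-below {n} j n<jk (yes k≤n) = T-below j (ℕP.≰⇒> (λ jk≤n∸k →
    ℕP.<⇒≱ n<jk (subst (_≤ n) (ℕP.+-comm (j * k) k) (ℕP.m≤o∸n⇒m+n≤o (j * k) k≤n jk≤n∸k))))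
  red-below j n<jk (no _) = refl

  T-rec-suc : ∀ n j → T n (suc j)
              ≡ (if does (k ≤? n) then T (n ∸ k) j else 0) + ∑ n (λ y → T (n ∸ suc y) (suc j))
  T-rec-suc n j with suc j * k ≤? n
  ... | yes jk≤n = begin
    T n (suc j)                                    ≡⟨ T-above (suc j) jk≤n ⟩
    aℕ (suc j) N                                   ≡⟨ aℕ-rec-suc j N ⟩
    aℕ j N + ∑ N (λ y → aℕ (suc j) (N ∸ suc y))    ≡⟨ cong₂ _+_ (red-above j jk≤n (k ≤? n)) (T-shift (suc j) jk≤n) ⟨
    (if does (k ≤? n) then T (n ∸ k) j else 0) + ∑ n (λ y → T (n ∸ suc y) (suc j)) ∎
    where
    open ≡-Reasoning
    N : ℕ
    N = n ∸ suc j * k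
  ... | no jk≰n = trans (T-below (suc j) n<jk) (sym (cong₂ _+_ (red-below j n<jk (k ≤? n))
         (∑-zero n (λ y _ → T-below (suc j) (ℕP.≤-<-trans (ℕP.m∸n≤m n (suc y)) n<jk)))))
    where
    n<jk : n < suc j * k
    n<jk = ℕP.≰⇒> jk≰n

module AlternatingSum (k′ : ℕ) where

  open ℤΣ
  open SignedSums
  open ShiftedTilings (suc k′) using (T; T-below; T-rec-0; T-rec-suc)

  k : ℕ
  k = suc k′

  G : ℕ → ℕ → ℤ
  G B n = ∑ B (λ j → sign j ℤ.* + T n j)

  F : ℕ → ℤ
  F n = G (suc n) n

  -- Terms with j > n vanish, since then jk > n.
  G-stable : ∀ {B n} → suc n ≤ B → G B n ≡ F n
  G-stable {B} {n} n<B = ∑-truncate n<B (λ j n<j _ →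
    trans (cong (λ t → sign j ℤ.* + t) (T-below j (ℕP.<-≤-trans n<j (ℕP.m≤m*n j k))))
          (ℤP.*-zeroʳ (sign j)))

  G-peel : ∀ B n → G (suc B) n ≡ + T n 0 - ∑ B (λ j → sign j ℤ.* + T n (suc j))
  G-peel B n = cong₂ ℤ._+_ (ℤP.*-identityˡ (+ T n 0)) (trans
    (∑-cong B (λ j _ → sym (ℤP.neg-distribˡ-* (sign j) (+ T n (suc j)))))
    (∑-neg B (λ j → sign j ℤ.* + T n (suc j))))

  redPart : ℕ → ℤ
  redPart n = if does (k ≤? n) then F (n ∸ k) else + 0

  red-sum : ∀ n (d : Dec (k ≤ n)) →
            ∑ n (λ j → sign j ℤ.* + (if does d then T (n ∸ k) j else 0))
            ≡ (if does d then F (n ∸ k) else + 0)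
  red-sum n (yes k≤n) = G-stable (ℕP.∸-monoʳ-< (s≤s z≤n) k≤n)
  red-sum n (no _)    = ∑-zero n (λ j _ → ℤP.*-zeroʳ (sign j))

  rec-0 : ∀ n → + T n 0 ≡ + δ₀ n ℤ.+ ∑ n (λ y → + T (n ∸ suc y) 0)
  rec-0 n = trans (cong +_ (T-rec-0 n))
                  (trans (ℤP.pos-+ (δ₀ n) _) (cong (ℤ._+_ (+ δ₀ n)) (pos-∑ n (λ y → T (n ∸ suc y) 0))))

  rec-suc : ∀ n → ∑ n (λ j → sign j ℤ.* + T n (suc j))
                  ≡ redPart n ℤ.+ ∑ n (λ y → ∑ n (λ j → sign j ℤ.* + T (n ∸ suc y) (suc j)))
  rec-suc n = begin
    ∑ n (λ j → sign j ℤ.* + T n (suc j))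
      ≡⟨ ∑-cong n (λ j _ → expand j) ⟩
    ∑ n (λ j → sign j ℤ.* + R j ℤ.+ ∑ n (λ y → sign j ℤ.* + T (n ∸ suc y) (suc j)))
      ≡⟨ ∑-distrib n _ _ ⟩
    ∑ n (λ j → sign j ℤ.* + R j) ℤ.+ ∑ n (λ j → ∑ n (λ y → sign j ℤ.* + T (n ∸ suc y) (suc j)))
      ≡⟨ cong₂ ℤ._+_ (red-sum n (k ≤? n)) (∑-comm n n (λ j y → sign j ℤ.* + T (n ∸ suc y) (suc j))) ⟩
    redPart n ℤ.+ ∑ n (λ y → ∑ n (λ j → sign j ℤ.* + T (n ∸ suc y) (suc j))) ∎
    where
    open ≡-Reasoning
    R : ℕ → ℕ
    R j = if does (k ≤? n) then T (n ∸ k) j else 0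
    expand : ∀ j → sign j ℤ.* + T n (suc j)
                   ≡ sign j ℤ.* + R j ℤ.+ ∑ n (λ y → sign j ℤ.* + T (n ∸ suc y) (suc j))
    expand j = begin
      sign j ℤ.* + T n (suc j)
        ≡⟨ cong (λ t → sign j ℤ.* + t) (T-rec-suc n j) ⟩
      sign j ℤ.* (+ (R j + ℕΣ.∑ n (λ y → T (n ∸ suc y) (suc j))))
        ≡⟨ cong (sign j ℤ.*_) (trans (ℤP.pos-+ (R j) _) (cong (ℤ._+_ (+ R j)) (pos-∑ n _))) ⟩
      sign j ℤ.* (+ R j ℤ.+ ∑ n (λ y → + T (n ∸ suc y) (suc j)))
        ≡⟨ ℤP.*-distribˡ-+ (sign j) (+ R j) _ ⟩
      sign j ℤ.* + R j ℤ.+ sign j ℤ.* ∑ n (λ y → + T (n ∸ suc y) (suc j))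
        ≡⟨ cong (ℤ._+_ (sign j ℤ.* + R j)) (∑-scale n (sign j) _) ⟩
      sign j ℤ.* + R j ℤ.+ ∑ n (λ y → sign j ℤ.* + T (n ∸ suc y) (suc j)) ∎

  -- The recursion for F: the j = 0 terms give [n = 0] and ∑_m T (n − m) 0, the
  -- others the red part and ∑_m of the j ≥ 1 terms at n − m; regroup by m.
  F-rec : ∀ n → F n ≡ (+ δ₀ n - redPart n) ℤ.+ ∑ n (λ y → F (n ∸ suc y))
  F-rec n = begin
    F n
      ≡⟨ G-peel n n ⟩
    + T n 0 - ∑ n (λ j → sign j ℤ.* + T n (suc j))
      ≡⟨ cong₂ _-_ (rec-0 n) (rec-suc n) ⟩
    (+ δ₀ n ℤ.+ ∑ n (λ y → + T (n ∸ suc y) 0)) - (redPart n ℤ.+ ∑ n (λ y → Tail y))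
      ≡⟨ rearrange (+ δ₀ n) (redPart n) (∑ n (λ y → + T (n ∸ suc y) 0)) (∑ n (λ y → Tail y)) ⟩
    (+ δ₀ n - redPart n) ℤ.+ (∑ n (λ y → + T (n ∸ suc y) 0) - ∑ n (λ y → Tail y))
      ≡⟨ cong (ℤ._+_ (+ δ₀ n - redPart n)) (∑-sub n _ _) ⟨
    (+ δ₀ n - redPart n) ℤ.+ ∑ n (λ y → + T (n ∸ suc y) 0 - Tail y)
      ≡⟨ cong (ℤ._+_ (+ δ₀ n - redPart n)) (∑-cong n (λ y _ →
           trans (sym (G-peel n (n ∸ suc y))) (G-stable (s≤s (ℕP.m∸n≤m n (suc y)))))) ⟩
    (+ δ₀ n - redPart n) ℤ.+ ∑ n (λ y → F (n ∸ suc y)) ∎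
    where
    open ≡-Reasoning
    Tail : ℕ → ℤ
    Tail y = ∑ n (λ j → sign j ℤ.* + T (n ∸ suc y) (suc j))

  -- The composition recursion, in ℤ, written with the index y = m − 1 ≠ k′.
  C-rec : ∀ n → + C-avoid n k
                ≡ + δ₀ n ℤ.+ ∑ n (λ y → if does (y ≟ k′) then + 0 else + C-avoid (n ∸ suc y) k)
  C-rec n = begin
    + C-avoid n k
      ≡⟨ cong +_ (Compositions.C-avoid-rec k n) ⟩
    + (δ₀ n + ℕΣ.∑ n (λ y → if does (y ≟ k′) then 0 else C-avoid (n ∸ suc y) k))
      ≡⟨ trans (ℤP.pos-+ (δ₀ n) _) (cong (ℤ._+_ (+ δ₀ n)) (pos-∑ n _)) ⟩
    + δ₀ n ℤ.+ ∑ n (λ y → + (if does (y ≟ k′) then 0 else C-avoid (n ∸ suc y) k))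
      ≡⟨ cong (ℤ._+_ (+ δ₀ n)) (∑-cong n (λ y _ → if-float +_ (does (y ≟ k′)))) ⟩
    + δ₀ n ℤ.+ ∑ n (λ y → if does (y ≟ k′) then + 0 else + C-avoid (n ∸ suc y) k) ∎
    where open ≡-Reasoning

  -- By strong induction: the recursion for C, with C = F below n, is the
  -- recursion for F once the term m = k is separated from ∑_m F(n − m).
  C≡F : ∀ n → + C-avoid n k ≡ F n
  C≡F = <-rec _ step
    where
    open ≡-Reasoning
    step : ∀ n → (∀ {m} → m < n → + C-avoid m k ≡ F m) → + C-avoid n k ≡ F n
    step n C≡F-below = begin
      + C-avoid n k
        ≡⟨ C-rec n ⟩
      + δ₀ n ℤ.+ ∑ n (λ y → if does (y ≟ k′) then + 0 else + C-avoid (n ∸ suc y) k)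
        ≡⟨ cong (ℤ._+_ (+ δ₀ n)) (∑-cong n (λ y y<n →
             if-cong-else (does (y ≟ k′)) (C≡F-below (remainder-< y<n)))) ⟩
      + δ₀ n ℤ.+ ∑ n (λ y → if does (y ≟ k′) then + 0 else F (n ∸ suc y))
        ≡⟨ cancel (+ δ₀ n) (redPart n) _ ⟨
      (+ δ₀ n - redPart n) ℤ.+ (redPart n ℤ.+ ∑ n (λ y → if does (y ≟ k′) then + 0 else F (n ∸ suc y)))
        ≡⟨ cong (ℤ._+_ (+ δ₀ n - redPart n)) (∑-separate n k′ (λ y → F (n ∸ suc y))) ⟨
      (+ δ₀ n - redPart n) ℤ.+ ∑ n (λ y → F (n ∸ suc y))
        ≡⟨ F-rec n ⟨
      F n ∎

mainTheorem11 : (n k : ℕ) → 1 ≤ n → 1 ≤ k →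
    + C-avoid n k ≡ Σ[j≤ n ] (λ j → sign j ℤ.* + a j (+ n - + (j * k)))
mainTheorem11 n (suc k′) _ _ = trans (C≡F n) (sym (SignedSums.Σ[j≤]≡∑ n _))
  where open AlternatingSum k′ using (C≡F)
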